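{- (Validity for terms in the contextual system.) If $\Psi;\Gamma\vdash_i t:T$, then $\mathrm{core}\,\Psi$, and if $i=0$ then $\mathrm{core}\,\Gamma$ and $\mathrm{core}\,T$, and if $i=1$ then $\mathrm{type}\,\Gamma$ and $\mathrm{type}\,T$.
   Context: Types: $T::=\mathsf{Nat}\mid(\Gamma\vdash T)\mid S\to T$. Core types ($\mathrm{core}$): built from $\mathsf{Nat}$, $\to$. Valid types ($\mathrm{type}$): $\mathsf{Nat}$; $S\to T$ with $S,T$ valid; $(\Gamma\vdash T)$ with $\Gamma$ and $T$ core. Local contexts $\Gamma::=\cdot\mid\Gamma,x:T$; global contexts $\Psi::=\cdot\mid\Psi,u:(\Gamma\vdash T)$; $\mathrm{core}\,\Psi$ means all types occurring in $\Psi$ (including in local contexts of bindings) are core; $\mathrm{core}/\mathrm{type}$ on local contexts are pointwise. Local substitutions $\delta::=\cdot\mid\delta,t/x$. Terms $t::=x\mid u^\delta\mid\mathsf{zero}\mid\mathsf{succ}\,t\mid\mathsf{box}\,t\mid\mathsf{letbox}\,u=s\,\mathsf{in}\,t\mid\mathsf{match}\,t\ \vec b\mid\lambda x.t\mid s\ t$; branches $b::=\mathsf{var}\,x\Rightarrow t\mid\mathsf{zero}\Rightarrow t\mid\mathsf{succ}\,?u\Rightarrow t\mid\lambda x.?u\Rightarrow t\mid ?u\ ?u'\Rightarrow t$. With $C_0$="$\mathrm{core}\,\Psi$, $\mathrm{core}\,\Gamma$", $C_1$="$\mathrm{core}\,\Psi$, $\mathrm{type}\,\Gamma$", typing ($i\in\{0,1\}$)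 is mutually inductive: under $C_i$: $\Psi;\Gamma\vdash_i\mathsf{zero}:\mathsf{Nat}$, $\Psi;\Gamma\vdash_i x:T$ for $x:T\in\Gamma$, $\Psi;\Gamma\vdash_i\cdot:\cdot$; $\Psi;\Gamma\vdash_i\delta:\Delta$, $\Psi;\Gamma\vdash_i t:T$ give $\Psi;\Gamma\vdash_i\delta,t/x:\Delta,x:T$; $\Psi;\Gamma\vdash_i\delta:\Delta$, $u:(\Delta\vdash T)\in\Psi$ give $\Psi;\Gamma\vdash_i u^\delta:T$; succ, $\lambda$ ($\Psi;\Gamma,x:S\vdash_i t:T$ gives $\lambda x.t:S\to T$), application at layer $i$; $\mathrm{type}\,\Gamma$ and $\Psi;\Delta\vdash_0 t:T$ give $\Psi;\Gamma\vdash_1\mathsf{box}\,t:(\Delta\vdash T)$; $\Psi;\Gamma\vdash_1 s:(\Delta\vdash T)$ and $\Psi,u:(\Delta\vdash T);\Gamma\vdash_1 t:T'$ give $\Psi;\Gamma\vdash_1\mathsf{letbox}\,u=s\,\mathsf{in}\,t:T'$; $\Psi;\Gamma\vdash_1 s:(\Delta\vdash T)$ and $\Psi;\Gamma\vdash_1\vec b:(\Delta\vdash T\Rightarrow T')$ give $\Psi;\Gamma\vdash_1\mathsf{match}\,s\ \vec b:T'$. Branches: $\Psi;\Gamma\vdash_1\mathsf{var}\,x\Rightarrow t:(\Delta\vdash T\Rightarrow T')$ if $\mathrm{core}\,\Delta$, $x:T\in\Delta$, $\Psi;\Gamma\vdash_1 t:T'$; $\mathsf{zero}\Rightarrow t:(\Delta\vdash\mathsf{Nat}\Rightarrow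 T')$ if $\mathrm{core}\,\Delta$, $\Psi;\Gamma\vdash_1 t:T'$; $\mathsf{succ}\,?u\Rightarrow t:(\Delta\vdash\mathsf{Nat}\Rightarrow T')$ if $\Psi,u:(\Delta\vdash\mathsf{Nat});\Gamma\vdash_1 t:T'$; $\lambda x.?u\Rightarrow t:(\Delta\vdash S\to T\Rightarrow T')$ if $\Psi,u:(\Delta,x:S\vdash T);\Gamma\vdash_1 t:T'$; $?u\ ?u'\Rightarrow t:(\Delta\vdash T\Rightarrow T')$ if for all core $S$, $\Psi,u:(\Delta\vdash S\to T),u':(\Delta\vdash S);\Gamma\vdash_1 t:T'$. $\Psi;\Gamma\vdash_1\vec b:(\Delta\vdash T\Rightarrow T')$: every branch typed, and $\vec b$ is a permutation of exactly one branch for each applicable head (for $T=\mathsf{Nat}$: $\mathsf{zero}$, $\mathsf{succ}$, application, and $\mathsf{var}\,x$ for each $x:\mathsf{Nat}\in\Delta$; for $T=S\to T_0$: $\lambda$, application, and $\mathsf{var}\,x$ for each $x:S\to T_0\in\Delta$). -}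

module Defs where

open import Data.Nat using (ℕ) renaming (_≟_ to _≟ℕ_)
open import Data.List using (List; []; _∷_; map)
open import Data.List.Relation.Unary.All using (All)
open import Data.List.Relation.Binary.Permutation.Propositional using (_↭_)
open import Data.Product using (_×_; _,_)
open import Data.Empty using (⊥)
open import Data.Unit using (⊤)
open import Relation.Nullary using (Dec; yes; no)
open import Relation.Binary.PropositionalEquality using (_≡_; refl; cong; cong₂)

Name : Set
Name = ℕ

infixr 30 _⇒_
infixl 20 _,_∶_

mutual
  data Ty : Set where
    Nat  : Ty
    ⟦_⊢_⟧ : Ctx → Ty → Ty
    _⇒_  : Ty → Ty → Ty

  data Ctx : Set where
    ·     : Ctx
    _,_∶_ : Ctx → Name → Ty → Ctx

data GCtx : Set where
  ·g      : GCtx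
  _,_∶⟦_⊢_⟧ : GCtx → Name → Ctx → Ty → GCtx

data _∶_∈_ : Name → Ty → Ctx → Set where
  here  : ∀ {Γ x T} → x ∶ T ∈ (Γ , x ∶ T)
  there : ∀ {Γ x T y S} → x ∶ T ∈ Γ → x ∶ T ∈ (Γ , y ∶ S)

data _∶⟦_⊢_⟧∈_ : Name → Ctx → Ty → GCtx → Set where
  here  : ∀ {Ψ u Δ T} → u ∶⟦ Δ ⊢ T ⟧∈ (Ψ , u ∶⟦ Δ ⊢ T ⟧)
  there : ∀ {Ψ u Δ T v Δ' T'} → u ∶⟦ Δ ⊢ T ⟧∈ Ψ → u ∶⟦ Δ ⊢ T ⟧∈ (Ψ , v ∶⟦ Δ' ⊢ T' ⟧)

data CoreTy : Ty → Set where
  Nat : CoreTy Nat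
  _⇒_ : ∀ {S T} → CoreTy S → CoreTy T → CoreTy (S ⇒ T)

data CoreCtx : Ctx → Set where
  · : CoreCtx ·
  _,_∶_ : ∀ {Γ T} → CoreCtx Γ → (x : Name) → CoreTy T → CoreCtx (Γ , x ∶ T)

data TypeTy : Ty → Set where
  Nat : TypeTy Nat
  _⇒_ : ∀ {S T} → TypeTy S → TypeTy T → TypeTy (S ⇒ T)
  box : ∀ {Γ T} → CoreCtx Γ → CoreTy T → TypeTy ⟦ Γ ⊢ T ⟧

data TypeCtx : Ctx → Set where
  · : TypeCtx ·
  _,_∶_ : ∀ {Γ T} → TypeCtx Γ → (x : Name) → TypeTy T → TypeCtx (Γ , x ∶ T)

data CoreGCtx : GCtx → Set where
  · : CoreGCtx ·g
  bind : ∀ {Ψ Δ T} → CoreGCtx Ψ → (u : Name) → CoreCtx Δ → CoreTy T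
       → CoreGCtx (Ψ , u ∶⟦ Δ ⊢ T ⟧)

mutual
  data Tm : Set where
    var    : Name → Tm
    mvar   : Name → Sub → Tm
    zero   : Tm
    succ   : Tm → Tm
    box    : Tm → Tm
    letbox : Name → Tm → Tm → Tm
    match  : Tm → List Branch → Tm
    lam    : Name → Tm → Tm
    app    : Tm → Tm → Tm

  data Sub : Set where
    ·     : Sub
    _,_/_ : Sub → Tm → Name → Sub

  data Branch : Set where
    bvar  : Name → Tm → Branch
    bzero : Tm → Branch
    bsucc : Name → Tm → Branch                 -- succ ?u ⇒ t
    blam  : Name → Name → Tm → Branch          -- λx.?u ⇒ t
    bapp  : Name → Name → Tm → Branch          -- ?u ?u' ⇒ t

data Head : Set where
  hvar  : Name → Head
  hzero hsucc hlam happ : Head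

head : Branch → Head
head (bvar x _)    = hvar x
head (bzero _)     = hzero
head (bsucc _ _)   = hsucc
head (blam _ _ _)  = hlam
head (bapp _ _ _)  = happ

mutual
  _≟Ty_ : (S T : Ty) → Dec (S ≡ T)
  Nat ≟Ty Nat = yes refl
  Nat ≟Ty ⟦ _ ⊢ _ ⟧ = no λ ()
  Nat ≟Ty (_ ⇒ _) = no λ ()
  ⟦ _ ⊢ _ ⟧ ≟Ty Nat = no λ ()
  ⟦ Γ ⊢ S ⟧ ≟Ty ⟦ Δ ⊢ T ⟧ with Γ ≟Ctx Δ | S ≟Ty T
  ... | yes refl | yes refl = yes refl
  ... | no ne | _ = no λ { refl → ne refl }
  ... | yes _ | no ne = no λ { refl → ne refl }
  ⟦ _ ⊢ _ ⟧ ≟Ty (_ ⇒ _) = no λ ()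
  (_ ⇒ _) ≟Ty Nat = no λ ()
  (_ ⇒ _) ≟Ty ⟦ _ ⊢ _ ⟧ = no λ ()
  (S ⇒ T) ≟Ty (S' ⇒ T') with S ≟Ty S' | T ≟Ty T'
  ... | yes refl | yes refl = yes refl
  ... | no ne | _ = no λ { refl → ne refl }
  ... | yes _ | no ne = no λ { refl → ne refl }

  _≟Ctx_ : (Γ Δ : Ctx) → Dec (Γ ≡ Δ)
  · ≟Ctx · = yes refl
  · ≟Ctx (_ , _ ∶ _) = no λ ()
  (_ , _ ∶ _) ≟Ctx · = no λ ()
  (Γ , x ∶ S) ≟Ctx (Δ , y ∶ T) with Γ ≟Ctx Δ | x ≟ℕ y | S ≟Ty T
  ... | yes refl | yes refl | yes refl = yes refl
  ... | no ne | _ | _ = no λ { refl → ne refl }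
  ... | yes _ | no ne | _ = no λ { refl → ne refl }
  ... | yes _ | yes _ | no ne = no λ { refl → ne refl }

varHeads : Ctx → Ty → List Head
varHeads · T = []
varHeads (Δ , x ∶ S) T with S ≟Ty T
... | yes _ = hvar x ∷ varHeads Δ T
... | no _  = varHeads Δ T

shapeHeads : Ty → List Head
shapeHeads Nat       = hzero ∷ hsucc ∷ happ ∷ []
shapeHeads (S ⇒ T)   = hlam ∷ happ ∷ []
shapeHeads ⟦ _ ⊢ _ ⟧ = happ ∷ []   -- not reachable for valid types (T core)

requiredHeads : Ctx → Ty → List Head
requiredHeads Δ T = shapeHeads T Data.List.++ varHeads Δ T

data Layer : Set where
  𝟘 𝟙 : Layer

Cond : Layer → GCtx → Ctx → Set
Cond 𝟘 Ψ Γ = CoreGCtx Ψ × CoreCtx Γ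
Cond 𝟙 Ψ Γ = CoreGCtx Ψ × TypeCtx Γ

mutual
  data _⨾_⊢[_]_∶_ : GCtx → Ctx → Layer → Tm → Ty → Set where
    t-zero : ∀ {i Ψ Γ} → Cond i Ψ Γ → Ψ ⨾ Γ ⊢[ i ] zero ∶ Nat
    t-var  : ∀ {i Ψ Γ x T} → Cond i Ψ Γ → x ∶ T ∈ Γ → Ψ ⨾ Γ ⊢[ i ] var x ∶ T
    t-mvar : ∀ {i Ψ Γ Δ δ u T} → Ψ ⨾ Γ ⊢s[ i ] δ ∶ Δ → u ∶⟦ Δ ⊢ T ⟧∈ Ψ
           → Ψ ⨾ Γ ⊢[ i ] mvar u δ ∶ T
    t-succ : ∀ {i Ψ Γ t} → Ψ ⨾ Γ ⊢[ i ] t ∶ Nat → Ψ ⨾ Γ ⊢[ i ] succ t ∶ Nat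
    t-lam  : ∀ {i Ψ Γ x t S T} → Ψ ⨾ (Γ , x ∶ S) ⊢[ i ] t ∶ T
           → Ψ ⨾ Γ ⊢[ i ] lam x t ∶ (S ⇒ T)
    t-app  : ∀ {i Ψ Γ s t S T} → Ψ ⨾ Γ ⊢[ i ] s ∶ (S ⇒ T) → Ψ ⨾ Γ ⊢[ i ] t ∶ S
           → Ψ ⨾ Γ ⊢[ i ] app s t ∶ T
    t-box  : ∀ {Ψ Γ Δ t T} → TypeCtx Γ → Ψ ⨾ Δ ⊢[ 𝟘 ] t ∶ T
           → Ψ ⨾ Γ ⊢[ 𝟙 ] box t ∶ ⟦ Δ ⊢ T ⟧
    t-letbox : ∀ {Ψ Γ Δ u s t T T'} → Ψ ⨾ Γ ⊢[ 𝟙 ] s ∶ ⟦ Δ ⊢ T ⟧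
             → (Ψ , u ∶⟦ Δ ⊢ T ⟧) ⨾ Γ ⊢[ 𝟙 ] t ∶ T'
             → Ψ ⨾ Γ ⊢[ 𝟙 ] letbox u s t ∶ T'
    t-match : ∀ {Ψ Γ Δ s bs T T'} → Ψ ⨾ Γ ⊢[ 𝟙 ] s ∶ ⟦ Δ ⊢ T ⟧
            → Ψ ⨾ Γ ⊢bs bs ∶ Δ ⊢ T ⇒ T'
            → Ψ ⨾ Γ ⊢[ 𝟙 ] match s bs ∶ T'

  data _⨾_⊢s[_]_∶_ : GCtx → Ctx → Layer → Sub → Ctx → Set where
    s-nil  : ∀ {i Ψ Γ} → Cond i Ψ Γ → Ψ ⨾ Γ ⊢s[ i ] · ∶ ·
    s-cons : ∀ {i Ψ Γ δ Δ t x T} → Ψ ⨾ Γ ⊢s[ i ] δ ∶ Δ → Ψ ⨾ Γ ⊢[ i ] t ∶ T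
           → Ψ ⨾ Γ ⊢s[ i ] (δ , t / x) ∶ (Δ , x ∶ T)

  data _⨾_⊢b_∶_⊢_⇒_ : GCtx → Ctx → Branch → Ctx → Ty → Ty → Set where
    b-var  : ∀ {Ψ Γ Δ x t T T'} → CoreCtx Δ → x ∶ T ∈ Δ → Ψ ⨾ Γ ⊢[ 𝟙 ] t ∶ T'
           → Ψ ⨾ Γ ⊢b bvar x t ∶ Δ ⊢ T ⇒ T'
    b-zero : ∀ {Ψ Γ Δ t T'} → CoreCtx Δ → Ψ ⨾ Γ ⊢[ 𝟙 ] t ∶ T'
           → Ψ ⨾ Γ ⊢b bzero t ∶ Δ ⊢ Nat ⇒ T'
    b-succ : ∀ {Ψ Γ Δ u t T'} → (Ψ , u ∶⟦ Δ ⊢ Nat ⟧) ⨾ Γ ⊢[ 𝟙 ] t ∶ T'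
           → Ψ ⨾ Γ ⊢b bsucc u t ∶ Δ ⊢ Nat ⇒ T'
    b-lam  : ∀ {Ψ Γ Δ x u t S T T'} → (Ψ , u ∶⟦ (Δ , x ∶ S) ⊢ T ⟧) ⨾ Γ ⊢[ 𝟙 ] t ∶ T'
           → Ψ ⨾ Γ ⊢b blam x u t ∶ Δ ⊢ (S ⇒ T) ⇒ T'
    b-app  : ∀ {Ψ Γ Δ u u' t T T'}
           → (∀ S → CoreTy S → ((Ψ , u ∶⟦ Δ ⊢ (S ⇒ T) ⟧) , u' ∶⟦ Δ ⊢ S ⟧) ⨾ Γ ⊢[ 𝟙 ] t ∶ T')
           → Ψ ⨾ Γ ⊢b bapp u u' t ∶ Δ ⊢ T ⇒ T'

  data _⨾_⊢bs_∶_⊢_⇒_ : GCtx → Ctx → List Branch → Ctx → Ty → Ty → Set where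
    bs : ∀ {Ψ Γ bs Δ T T'}
       → All (λ b → Ψ ⨾ Γ ⊢b b ∶ Δ ⊢ T ⇒ T') bs
       → map head bs ↭ requiredHeads Δ T
       → Ψ ⨾ Γ ⊢bs bs ∶ Δ ⊢ T ⇒ T'

Valid : Layer → GCtx → Ctx → Ty → Set
Valid 𝟘 Ψ Γ T = CoreGCtx Ψ × CoreCtx Γ × CoreTy T
Valid 𝟙 Ψ Γ T = CoreGCtx Ψ × TypeCtx Γ × TypeTy T

-- The side conditions C_i at the leaves (and the
-- premise type Γ of box) supply the context half of the claim; the type half is
-- read off a context or assembled from the types in the premises. A match has
-- at least one branch, because the application head is always required, and
-- the body of any branch has the result type.
module Submission where

open import Defs
open import Data.List using ([]; _∷_)
open import Data.List.Relation.Unary.All using ([]; _∷_)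
open import Data.List.Relation.Binary.Permutation.Propositional using (_↭_; ↭-sym)
open import Data.List.Relation.Binary.Permutation.Propositional.Properties using (¬x∷xs↭[])
open import Data.Product using (_,_)
open import Data.Empty using (⊥-elim)
open import Relation.Nullary using (¬_)

core⇒type : ∀ {T} → CoreTy T → TypeTy T
core⇒type Nat     = Nat
core⇒type (S ⇒ T) = core⇒type S ⇒ core⇒type T

CoreCtx-lookup : ∀ {Γ x T} → CoreCtx Γ → x ∶ T ∈ Γ → CoreTy T
CoreCtx-lookup (_ , _ ∶ τ) here      = τ
CoreCtx-lookup (γ , _ ∶ _) (there p) = CoreCtx-lookup γ p

TypeCtx-lookup : ∀ {Γ x T} → TypeCtx Γ → x ∶ T ∈ Γ → TypeTy T
TypeCtx-lookup (_ , _ ∶ τ) here      = τ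
TypeCtx-lookup (γ , _ ∶ _) (there p) = TypeCtx-lookup γ p

CoreGCtx-lookup : ∀ {Ψ u Δ T} → CoreGCtx Ψ → u ∶⟦ Δ ⊢ T ⟧∈ Ψ → CoreTy T
CoreGCtx-lookup (bind _ _ _ τ) here      = τ
CoreGCtx-lookup (bind ψ _ _ _) (there p) = CoreGCtx-lookup ψ p

¬[]↭requiredHeads : ∀ Δ T → ¬ ([] ↭ requiredHeads Δ T)
¬[]↭requiredHeads _ Nat       p = ¬x∷xs↭[] (↭-sym p)
¬[]↭requiredHeads _ ⟦ _ ⊢ _ ⟧ p = ¬x∷xs↭[] (↭-sym p)
¬[]↭requiredHeads _ (_ ⇒ _)   p = ¬x∷xs↭[] (↭-sym p)

module _ {Ψ : GCtx} {Γ : Ctx} where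

  valid-core : ∀ {i T} → Cond i Ψ Γ → CoreTy T → Valid i Ψ Γ T
  valid-core {𝟘} (ψ , γ) τ = ψ , γ , τ
  valid-core {𝟙} (ψ , γ) τ = ψ , γ , core⇒type τ

  valid-var : ∀ {i x T} → Cond i Ψ Γ → x ∶ T ∈ Γ → Valid i Ψ Γ T
  valid-var {𝟘} (ψ , γ) p = ψ , γ , CoreCtx-lookup γ p
  valid-var {𝟙} (ψ , γ) p = ψ , γ , TypeCtx-lookup γ p

  valid-mvar : ∀ {i u Δ T} → Cond i Ψ Γ → u ∶⟦ Δ ⊢ T ⟧∈ Ψ → Valid i Ψ Γ T
  valid-mvar {𝟘} c@(ψ , _) p = valid-core {i = 𝟘} c (CoreGCtx-lookup ψ p)
  valid-mvar {𝟙} c@(ψ , _) p = valid-core {i = 𝟙} c (CoreGCtx-lookup ψ p)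

  valid-lam : ∀ {i x S T} → Valid i Ψ (Γ , x ∶ S) T → Valid i Ψ Γ (S ⇒ T)
  valid-lam {𝟘} (ψ , (γ , _ ∶ σ) , τ) = ψ , γ , σ ⇒ τ
  valid-lam {𝟙} (ψ , (γ , _ ∶ σ) , τ) = ψ , γ , σ ⇒ τ

  valid-cod : ∀ {i S T} → Valid i Ψ Γ (S ⇒ T) → Valid i Ψ Γ T
  valid-cod {𝟘} (ψ , γ , _ ⇒ τ) = ψ , γ , τ
  valid-cod {𝟙} (ψ , γ , _ ⇒ τ) = ψ , γ , τ

valid₁-type : ∀ {Ψ Γ T} → Valid 𝟙 Ψ Γ T → TypeTy T
valid₁-type (_ , _ , τ) = τ

mutual
  mainTheorem11 : ∀ {i Ψ Γ t T} → Ψ ⨾ Γ ⊢[ i ] t ∶ T → Valid i Ψ Γ T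
  mainTheorem11 (t-zero c)      = valid-core c Nat
  mainTheorem11 (t-var c p)     = valid-var c p
  mainTheorem11 (t-mvar δ p)    = valid-mvar (⊢s-cond δ) p
  mainTheorem11 (t-succ d)      = mainTheorem11 d
  mainTheorem11 (t-lam d)       = valid-lam (mainTheorem11 d)
  mainTheorem11 (t-app d _)     = valid-cod (mainTheorem11 d)
  mainTheorem11 (t-box γ d)     =
    let ψ , δ , τ = mainTheorem11 d in ψ , γ , box δ τ
  mainTheorem11 (t-letbox d e)  =
    let ψ , γ , _ = mainTheorem11 d in ψ , γ , valid₁-type (mainTheorem11 e)
  mainTheorem11 (t-match {Δ = Δ} {T = T} _ (bs [] p)) =
    ⊥-elim (¬[]↭requiredHeads Δ T p)
  mainTheorem11 (t-match d (bs (b ∷ _) _)) =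
    let ψ , γ , _ = mainTheorem11 d in ψ , γ , ⊢b-type b

  ⊢s-cond : ∀ {i Ψ Γ δ Δ} → Ψ ⨾ Γ ⊢s[ i ] δ ∶ Δ → Cond i Ψ Γ
  ⊢s-cond (s-nil c)    = c
  ⊢s-cond (s-cons δ _) = ⊢s-cond δ

  ⊢b-type : ∀ {Ψ Γ b Δ T T'} → Ψ ⨾ Γ ⊢b b ∶ Δ ⊢ T ⇒ T' → TypeTy T'
  ⊢b-type (b-var _ _ d) = valid₁-type (mainTheorem11 d)
  ⊢b-type (b-zero _ d)  = valid₁-type (mainTheorem11 d)
  ⊢b-type (b-succ d)    = valid₁-type (mainTheorem11 d)
  ⊢b-type (b-lam d)     = valid₁-type (mainTheorem11 d)
  -- the premise holds for every core S; Nat is one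
  ⊢b-type (b-app d)     = valid₁-type (mainTheorem11 (d Nat Nat))
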